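{- For every $n\in\mathbb N$, $$\Lambda^*(n)=\sum_{\substack{d\mid n\\ \kappa(d)=\kappa(n)}}\Lambda(d).$$
   Context: $\Lambda$ is the von Mangoldt function. $d\mid\mid n$ means $d\mid n,\ \gcd(d,n/d)=1$. $\Lambda^*$ is the unitary von Mangoldt function, i.e. the unique arithmetic function satisfying $\sum_{d\mid\mid n}\Lambda^*(d)=\log n$ for all $n\in\mathbb N$ (equivalently $\Lambda^*(n)=\sum_{d\mid\mid n}(-1)^{\omega(n/d)}\log d$, $\omega$ counting distinct prime factors). $\kappa(n)=\prod_{p\mid n}p$ is the squarefree kernel. -}

module Defs where

open import Data.Nat using (ℕ; zero; suc; _^_; _/_; _%_; _≟_)
open import Data.Nat.Divisibility using (_∣?_)
open import Data.Nat.GCD using (gcd)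
open import Data.Nat.Primality using (prime?)
open import Data.List using (List; []; _∷_; filter; map; upTo; length; foldr; concatMap)
open import Data.Integer using (+_)
open import Data.Rational as ℚ using (ℚ; 1ℚ)
open import Relation.Nullary.Decidable using (_×-dec_; yes; no)
open import Data.Nat.ListAction using (product)

range : ℕ → List ℕ
range n = map suc (upTo n)

divisors : ℕ → List ℕ
divisors n = filter (λ d → d ∣? n) (range n)

unitaryDivisors : ℕ → List ℕ
unitaryDivisors n =
  map suc (filter (λ k → (suc k ∣? n) ×-dec (gcd (suc k) (n / suc k) ≟ 1)) (upTo n))

primeDivisors : ℕ → List ℕ
primeDivisors n = filter (λ p → prime? p ×-dec (p ∣? n)) (range n)

ω : ℕ → ℕ
ω n = length (primeDivisors n)

κ : ℕ → ℕ
κ n = product (primeDivisors n)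

-- Logarithmic values are represented through the isomorphism exp : (ℝ,+) ≅ (ℝ_{>0},·);
-- all values occurring here are exponentials of ℤ-combinations of logs of integers,
-- hence positive rationals.

prodℚ : List ℚ → ℚ
prodℚ = foldr ℚ._*_ 1ℚ

-- expΛ d = exp(Λ(d)) = ∏_{p prime, k ≥ 1, p^k = d} p  (a product with at most one factor),
-- i.e. p if d = p^k with k ≥ 1, and 1 otherwise.
expΛ : ℕ → ℚ
expΛ d = prodℚ (concatMap (λ p → concatMap (λ k → term p k) (range d))
                          (filter (λ p → prime? p) (range d)))
  where
  term : ℕ → ℕ → List ℚ
  term p k with p ^ k ≟ d
  ... | yes _ = (+ p ℚ./ 1) ∷ []
  ... | no  _ = []

signedPow : ℕ → ℕ → ℚ
signedPow zero    m = 1ℚ   -- not used (d ≥ 1)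
signedPow (suc k) m with ω m % 2 ≟ 0
... | yes _ = + suc k ℚ./ 1
... | no  _ = + 1 ℚ./ suc k

-- expΛstar n = exp(Λ*(n)) = ∏_{d ∣∣ n} d^{(-1)^{ω(n/d)}},
-- i.e. Λ*(n) = ∑_{d ∣∣ n} (-1)^{ω(n/d)} log d
expΛstar : ℕ → ℚ
expΛstar n = prodℚ (map (λ k → signedPow (suc k) (n / suc k))
                        (filter (λ k → (suc k ∣? n) ×-dec (gcd (suc k) (n / suc k) ≟ 1)) (upTo n)))

-- exp of  ∑_{d ∣ n, κ(d) = κ(n)} Λ(d)
expRHS : ℕ → ℚ
expRHS n = prodℚ (map expΛ (filter (λ d → κ d ≟ κ n) (divisors n)))

-- Write n = q·m where q = p^a is the exact power of a prime p dividing n. The unitary divisors of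
-- n are the d and q·d with d ∥ m, and the factors d^(-ε) and (q·d)^ε of such a pair, where
-- ε = (-1)^ω(m/d), combine to q^ε. Hence exp Λ*(n) = ∏_{d ∥ m} q^((-1)^ω(m/d)), which is q for
-- m = 1; for m > 1 the exponent ∑_{d ∥ m} (-1)^ω(m/d) vanishes by the same pairing, now applied to
-- a prime power dividing m exactly. On the other side, Λ(d) ≠ 0 only for prime powers d, and then
-- κ(d) = κ(n) forces n to be a power of the same prime p; the divisors p, p², …, p^a of n = p^a
-- each contribute log p.
module Submission where

open import Defs
open import Data.Nat using (ℕ; _≤_)
open import Relation.Binary.PropositionalEquality using (_≡_)

open import Algebra.Bundles using (CommutativeMonoid)
import Algebra.Properties.CommutativeSemigroup as CommSemigroupProperties
open import Data.Empty using (⊥-elim)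
open import Data.Integer using (+_)
import Data.Integer.Properties as ℤ
open import Data.List using (List; []; _∷_; _++_; map; filter; concatMap; length; upTo)
open import Data.List.Properties
  using (map-++; map-∘; map-cong-local; concatMap-cong; length-map; length-upTo; ++-identityʳ)
open import Data.List.Membership.Propositional using (_∈_)
open import Data.List.Membership.Propositional.Properties
  using (∈-map⁺; ∈-map⁻; ∈-filter⁺; ∈-filter⁻; ∈-upTo⁺; ∈-upTo⁻; ∈-++⁺ˡ; ∈-++⁺ʳ; ∈-++⁻)
open import Data.List.Membership.Propositional.Properties.WithK using (unique∧set⇒bag)
open import Data.List.Relation.Binary.BagAndSetEquality using (∼bag⇒↭)
open import Data.List.Relation.Binary.Permutation.Propositional using (_↭_; ↭⇒↭ₛ)
import Data.List.Relation.Binary.Permutation.Propositional.Properties as ↭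
open import Data.List.Relation.Binary.Permutation.Setoid.Properties using (foldr-commMonoid)
open import Data.List.Relation.Unary.All using (All)
import Data.List.Relation.Unary.All as All
open import Data.List.Relation.Unary.AllPairs using (_∷_)
open import Data.List.Relation.Unary.Any using (here; there)
open import Data.List.Relation.Unary.Unique.Propositional using (Unique)
import Data.List.Relation.Unary.Unique.Propositional.Properties as Unique
open import Data.Nat
  using (zero; suc; _*_; _∸_; _^_; _/_; _%_; _<_; _≟_; z≤n; s≤s; NonZero; ≢-nonZero; ≢-nonZero⁻¹; nonTrivial⇒n>1)
open import Data.Nat.Coprimality as Coprime
  using (Coprime; coprime-divisor; coprime⇒gcd≡1; gcd≡1⇒coprime)
open import Data.Nat.DivMod using (m*n/n≡m; m/n*n≡m)
open import Data.Nat.Divisibility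
open import Data.Nat.GCD using (gcd)
open import Data.Nat.Induction using (<-rec)
open import Data.Nat.ListAction using (product)
open import Data.Nat.ListAction.Properties using (product-↭)
open import Data.Nat.Primality
  using (Prime; prime?; euclidsLemma; prime⇒irreducible; prime⇒nonTrivial; prime⇒nonZero)
open import Data.Nat.Primality.Factorisation using (factorise)
open import Data.Nat.Properties
open import Data.Product using (∃; ∃₂; _×_; _,_; proj₁; proj₂)
open import Data.Rational as ℚ using (ℚ; 1ℚ; fromℚᵘ)
import Data.Rational.Properties as ℚ
import Data.Rational.Unnormalised as ℚᵘ
import Data.Rational.Unnormalised.Properties as ℚᵘ
open import Data.Sum using (_⊎_; inj₁; inj₂)
open import Function using (_∘_)
open import Function.Bundles using (mk⇔)
open import Relation.Binary.Definitions using (tri<; tri≈; tri>)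
open import Relation.Binary.PropositionalEquality
open import Relation.Nullary using (¬_; Dec; yes; no)
open import Relation.Nullary.Decidable using (_×-dec_)

module ℚ* = CommutativeMonoid ℚ.*-1-commutativeMonoid
open CommSemigroupProperties ℚ*.commutativeSemigroup using (interchange; x∙yz≈y∙xz)
open CommSemigroupProperties *-commutativeSemigroup using () renaming (x∙yz≈y∙xz to x*[y*z]≡y*[x*z])

⟦_⟧ : ℕ → ℚ
⟦ n ⟧ = + n ℚ./ 1

⟦_⟧⁻¹ : (n : ℕ) .{{_ : NonZero n}} → ℚ
⟦ n ⟧⁻¹ = + 1 ℚ./ n

fromℚᵘ-homo-* : ∀ p q → fromℚᵘ (p ℚᵘ.* q) ≡ fromℚᵘ p ℚ.* fromℚᵘ q
fromℚᵘ-homo-* p q = ℚ.toℚᵘ-injective (ℚᵘ.≃-trans (ℚ.toℚᵘ-fromℚᵘ (p ℚᵘ.* q)) (ℚᵘ.≃-sym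
  (ℚᵘ.≃-trans (ℚ.toℚᵘ-homo-* (fromℚᵘ p) (fromℚᵘ q)) (ℚᵘ.*-cong (ℚ.toℚᵘ-fromℚᵘ p) (ℚ.toℚᵘ-fromℚᵘ q)))))

⟦⟧-homo-* : ∀ m n → ⟦ m * n ⟧ ≡ ⟦ m ⟧ ℚ.* ⟦ n ⟧
⟦⟧-homo-* m n = trans (cong (λ z → fromℚᵘ (ℚᵘ.mkℚᵘ z 0)) (ℤ.pos-* m n))
                      (fromℚᵘ-homo-* (ℚᵘ.mkℚᵘ (+ m) 0) (ℚᵘ.mkℚᵘ (+ n) 0))

⟦⟧⁻¹-homo-* : ∀ m n → ⟦ suc m * suc n ⟧⁻¹ ≡ ⟦ suc m ⟧⁻¹ ℚ.* ⟦ suc n ⟧⁻¹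
⟦⟧⁻¹-homo-* m n = fromℚᵘ-homo-* (ℚᵘ.mkℚᵘ (+ 1) m) (ℚᵘ.mkℚᵘ (+ 1) n)

⟦⟧-inverseʳ : ∀ n .{{_ : NonZero n}} → ⟦ n ⟧ ℚ.* ⟦ n ⟧⁻¹ ≡ 1ℚ
⟦⟧-inverseʳ (suc k) = trans (sym (fromℚᵘ-homo-* n (ℚᵘ.1/ n))) (ℚ.fromℚᵘ-cong (ℚᵘ.*-inverseʳ n))
  where n = ℚᵘ.mkℚᵘ (+ suc k) 0

m%2≡0⇒[1+m]%2≢0 : ∀ m → m % 2 ≡ 0 → suc m % 2 ≢ 0
m%2≡0⇒[1+m]%2≢0 zero          _ ()
m%2≡0⇒[1+m]%2≢0 (suc (suc m)) e = m%2≡0⇒[1+m]%2≢0 m e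

m%2≢0⇒[1+m]%2≡0 : ∀ m → m % 2 ≢ 0 → suc m % 2 ≡ 0
m%2≢0⇒[1+m]%2≡0 zero          ne = ⊥-elim (ne refl)
m%2≢0⇒[1+m]%2≡0 (suc zero)    _  = refl
m%2≢0⇒[1+m]%2≡0 (suc (suc m)) ne = m%2≢0⇒[1+m]%2≡0 m ne

signedPow-inverse : ∀ x {m m′} → ω m′ ≡ suc (ω m) → signedPow x m′ ℚ.* signedPow x m ≡ 1ℚ
signedPow-inverse zero    _ = refl
signedPow-inverse (suc k) {m} {m′} ω≡ with ω m % 2 ≟ 0 | ω m′ % 2 ≟ 0
... | yes even | yes even′ = ⊥-elim (m%2≡0⇒[1+m]%2≢0 (ω m) even (subst (λ w → w % 2 ≡ 0) ω≡ even′))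
... | yes _    | no _      = trans (ℚ.*-comm ⟦ suc k ⟧⁻¹ ⟦ suc k ⟧) (⟦⟧-inverseʳ (suc k))
... | no _     | yes _     = ⟦⟧-inverseʳ (suc k)
... | no odd   | no odd′   = ⊥-elim (odd′ (subst (λ w → w % 2 ≡ 0) (sym ω≡) (m%2≢0⇒[1+m]%2≡0 (ω m) odd)))

signedPow-* : ∀ x y m .{{_ : NonZero x}} .{{_ : NonZero y}} →
              signedPow (x * y) m ≡ signedPow x m ℚ.* signedPow y m
signedPow-* (suc a) (suc b) m with ω m % 2 ≟ 0
... | yes _ = ⟦⟧-homo-* (suc a) (suc b)
... | no _  = ⟦⟧⁻¹-homo-* a b

signedPow-cancel : ∀ d q {e e′} .{{_ : NonZero d}} .{{_ : NonZero q}} → ω e′ ≡ suc (ω e) →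
                   signedPow d e′ ℚ.* signedPow (q * d) e ≡ signedPow q e
signedPow-cancel d q {e} {e′} ω≡ = begin
  signedPow d e′ ℚ.* signedPow (q * d) e
    ≡⟨ cong (signedPow d e′ ℚ.*_) (signedPow-* q d e) ⟩
  signedPow d e′ ℚ.* (signedPow q e ℚ.* signedPow d e)
    ≡⟨ x∙yz≈y∙xz (signedPow d e′) (signedPow q e) (signedPow d e) ⟩
  signedPow q e ℚ.* (signedPow d e′ ℚ.* signedPow d e)
    ≡⟨ cong (signedPow q e ℚ.*_) (signedPow-inverse d ω≡) ⟩
  signedPow q e ℚ.* 1ℚ
    ≡⟨ ℚ.*-identityʳ _ ⟩
  signedPow q e
    ∎
  where open ≡-Reasoning

signedPow-1 : ∀ x .{{_ : NonZero x}} → signedPow x 1 ≡ ⟦ x ⟧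
signedPow-1 (suc k) = refl


prodℚ-↭ : ∀ {xs ys} → xs ↭ ys → prodℚ xs ≡ prodℚ ys
prodℚ-↭ xs↭ys = foldr-commMonoid ℚ*.setoid ℚ*.isCommutativeMonoid (↭⇒↭ₛ xs↭ys)

prodℚ-++ : ∀ xs ys → prodℚ (xs ++ ys) ≡ prodℚ xs ℚ.* prodℚ ys
prodℚ-++ []       ys = sym (ℚ.*-identityˡ (prodℚ ys))
prodℚ-++ (x ∷ xs) ys =
  trans (cong (x ℚ.*_) (prodℚ-++ xs ys)) (sym (ℚ.*-assoc x (prodℚ xs) (prodℚ ys)))

prodℚ-map-* : ∀ {A : Set} (f g : A → ℚ) xs →
              prodℚ (map (λ x → f x ℚ.* g x) xs) ≡ prodℚ (map f xs) ℚ.* prodℚ (map g xs)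
prodℚ-map-* f g []       = refl
prodℚ-map-* f g (x ∷ xs) =
  trans (cong (f x ℚ.* g x ℚ.*_) (prodℚ-map-* f g xs)) (interchange (f x) (g x) _ _)

prodℚ-cong : ∀ {A : Set} {f g : A → ℚ} {xs} →
             (∀ {x} → x ∈ xs → f x ≡ g x) → prodℚ (map f xs) ≡ prodℚ (map g xs)
prodℚ-cong f≡g = cong prodℚ (map-cong-local (All.tabulate f≡g))

prodℚ-ones : ∀ {A : Set} {f : A → ℚ} {xs} →
             (∀ {x} → x ∈ xs → f x ≡ 1ℚ) → prodℚ (map f xs) ≡ 1ℚ
prodℚ-ones {xs = []}     _   = refl
prodℚ-ones {xs = x ∷ xs} f≡1 = cong₂ ℚ._*_ (f≡1 (here refl)) (prodℚ-ones (f≡1 ∘ there))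

prodℚ-const : ∀ {A : Set} n (xs : List A) → prodℚ (map (λ _ → ⟦ n ⟧) xs) ≡ ⟦ n ^ length xs ⟧
prodℚ-const n []       = refl
prodℚ-const n (x ∷ xs) =
  trans (cong (⟦ n ⟧ ℚ.*_) (prodℚ-const n xs)) (sym (⟦⟧-homo-* n (n ^ length xs)))

unique-set⇒↭ : ∀ {A : Set} {xs ys : List A} → Unique xs → Unique ys →
               (∀ {x} → x ∈ xs → x ∈ ys) → (∀ {x} → x ∈ ys → x ∈ xs) → xs ↭ ys
unique-set⇒↭ uxs uys to from = ∼bag⇒↭ (unique∧set⇒bag uxs uys (mk⇔ to from))

concatMap-[] : ∀ {A B : Set} (f : A → List B) {xs} →
               (∀ {x} → x ∈ xs → f x ≡ []) → concatMap f xs ≡ []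
concatMap-[] f {[]}     _    = refl
concatMap-[] f {x ∷ xs} f≡[] = cong₂ _++_ (f≡[] (here refl)) (concatMap-[] f (f≡[] ∘ there))

concatMap-single : ∀ {B : Set} (f : ℕ → List B) {xs x₀} → Unique xs → x₀ ∈ xs →
                   (∀ {x} → x ∈ xs → x ≢ x₀ → f x ≡ []) → concatMap f xs ≡ f x₀
concatMap-single f {x ∷ xs} {x₀} (x∉xs ∷ u) x₀∈ f≡[] with x ≟ x₀ | x₀∈
... | yes refl | _ =
  trans (cong (f x ++_) (concatMap-[] f λ y∈ → f≡[] (there y∈) λ y≡x → All.lookup x∉xs y∈ (sym y≡x)))
        (++-identityʳ (f x))
... | no x≢x₀ | here x₀≡x   = ⊥-elim (x≢x₀ (sym x₀≡x))
... | no x≢x₀ | there x₀∈xs =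
  trans (cong (_++ concatMap f xs) (f≡[] (here refl) x≢x₀)) (concatMap-single f u x₀∈xs (f≡[] ∘ there))


-- Primes, powers and coprimality

prime>1 : ∀ {p} → Prime p → 1 < p
prime>1 {p} pp = nonTrivial⇒n>1 p {{prime⇒nonTrivial pp}}

prime≢1 : ∀ {p} → Prime p → p ≢ 1
prime≢1 pp refl = <-irrefl refl (prime>1 pp)

prime^a≢0 : ∀ {p} → Prime p → ∀ a → p ^ a ≢ 0
prime^a≢0 {p} pp a = ≢-nonZero⁻¹ (p ^ a) {{m^n≢0 p a {{prime⇒nonZero pp}}}}

m≢0∧n≢0⇒m*n≢0 : ∀ {m n} → m ≢ 0 → n ≢ 0 → m * n ≢ 0
m≢0∧n≢0⇒m*n≢0 m≢0 n≢0 mn≡0 with m*n≡0⇒m≡0∨n≡0 _ mn≡0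
... | inj₁ m≡0 = m≢0 m≡0
... | inj₂ n≡0 = n≢0 n≡0

p∣p^a : ∀ p {a} → 1 ≤ a → p ∣ p ^ a
p∣p^a p {suc a} _ = m∣m*n (p ^ a)

m^i∣m^j : ∀ m {i j} → i ≤ j → m ^ i ∣ m ^ j
m^i∣m^j m {i} {j} i≤j =
  divides (m ^ (j ∸ i)) (trans (cong (m ^_) (sym (m∸n+n≡m i≤j))) (^-distribˡ-+-* m (j ∸ i) i))

n<m^n : ∀ {m} → 1 < m → ∀ n → n < m ^ n
n<m^n 1<m zero    = s≤s z≤n
n<m^n 1<m (suc n) = ≤-<-trans (n<m^n 1<m n) (^-monoʳ-< _ 1<m (n<1+n n))

^-injectiveʳ : ∀ {p} → 1 < p → ∀ {i j} → p ^ i ≡ p ^ j → i ≡ j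
^-injectiveʳ {p} 1<p {i} {j} eq with <-cmp i j
... | tri< i<j _ _ = ⊥-elim (<-irrefl eq (^-monoʳ-< p 1<p i<j))
... | tri≈ _ i≡j _ = i≡j
... | tri> _ _ j<i = ⊥-elim (<-irrefl (sym eq) (^-monoʳ-< p 1<p j<i))

prime∣prime⇒≡ : ∀ {x p} → Prime x → Prime p → x ∣ p → x ≡ p
prime∣prime⇒≡ px pp x∣p with prime⇒irreducible pp x∣p
... | inj₁ x≡1 = ⊥-elim (prime≢1 px x≡1)
... | inj₂ x≡p = x≡p

prime∣p^a⇒≡ : ∀ {x p} → Prime x → Prime p → ∀ a → x ∣ p ^ a → x ≡ p
prime∣p^a⇒≡ px pp zero    x∣1 = ⊥-elim (prime≢1 px (∣1⇒≡1 x∣1))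
prime∣p^a⇒≡ px pp (suc a) x∣p^[1+a] with euclidsLemma _ (_ ^ a) px x∣p^[1+a]
... | inj₁ x∣p   = prime∣prime⇒≡ px pp x∣p
... | inj₂ x∣p^a = prime∣p^a⇒≡ px pp a x∣p^a

coprime-* : ∀ {d m n} → Coprime d m → Coprime d n → Coprime d (m * n)
coprime-* cm cn (i∣d , i∣mn) =
  cn (i∣d , coprime-divisor (λ (j∣i , j∣m) → cm (∣-trans j∣i i∣d , j∣m)) i∣mn)

coprime-^ : ∀ {m n} a → Coprime m n → Coprime m (n ^ a)
coprime-^ zero    _ (_ , i∣1) = ∣1⇒≡1 i∣1
coprime-^ (suc a) c = coprime-* c (coprime-^ a c)

coprime-∣ : ∀ {m n d e} → Coprime m n → d ∣ m → e ∣ n → Coprime d e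
coprime-∣ c d∣m e∣n (i∣d , i∣e) = c (∣-trans i∣d d∣m , ∣-trans i∣e e∣n)

prime-coprime : ∀ {p m} → Prime p → ¬ p ∣ m → Coprime p m
prime-coprime pp p∤m (i∣p , i∣m) with prime⇒irreducible pp i∣p
... | inj₁ i≡1 = i≡1
... | inj₂ refl = ⊥-elim (p∤m i∣m)

coprime-p^a : ∀ {p m} → Prime p → ¬ p ∣ m → ∀ a → Coprime m (p ^ a)
coprime-p^a pp p∤m a = coprime-^ a (Coprime.sym (prime-coprime pp p∤m))

∣p^a⇒≡p^j : ∀ {p d} → Prime p → ∀ a → d ∣ p ^ a → ∃ λ j → j ≤ a × d ≡ p ^ j
∣p^a⇒≡p^j pp zero d∣1 = 0 , z≤n , ∣1⇒≡1 d∣1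
∣p^a⇒≡p^j {p} {d} pp (suc a) d∣p^[1+a] with p ∣? d
... | no p∤d =
  let j , j≤a , d≡p^j = ∣p^a⇒≡p^j pp a (coprime-divisor (Coprime.sym (prime-coprime pp p∤d)) d∣p^[1+a])
  in  j , m≤n⇒m≤1+n j≤a , d≡p^j
... | yes (divides k refl) =
  let k∣p^a = *-cancelˡ-∣ p {{prime⇒nonZero pp}} (subst (_∣ p ^ suc a) (*-comm k p) d∣p^[1+a])
      j , j≤a , k≡p^j = ∣p^a⇒≡p^j pp a k∣p^a
  in  suc j , s≤s j≤a , trans (cong (_* p) k≡p^j) (*-comm (p ^ j) p)

coprime-cancel : ∀ {q x y m} → q ≢ 0 → Coprime q y → x * y ≡ q * m →
                 ∃ λ x′ → x ≡ q * x′ × x′ * y ≡ m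
coprime-cancel {q} {x} {y} {m} q≢0 cop xy≡qm
  with coprime-divisor cop (divides m (trans (*-comm y x) (trans xy≡qm (*-comm q m))))
... | divides x′ refl = x′ , *-comm x′ q , *-cancelˡ-≡ (x′ * y) m q {{≢-nonZero q≢0}} q*x′y≡q*m
  where
  q*x′y≡q*m : q * (x′ * y) ≡ q * m
  q*x′y≡q*m = trans (sym (*-assoc q x′ y)) (trans (cong (_* y) (*-comm q x′)) xy≡qm)

primeFactor : ∀ {n} → 2 ≤ n → ∃ λ p → Prime p × p ∣ n
primeFactor {n@(suc (suc _))} _ with factorise n
... | record { factors = p ∷ ps ; isFactorisation = n≡p*∏ps ; factorsPrime = pp All.∷ _ } =
  p , pp , divides (product ps) (trans n≡p*∏ps (*-comm p (product ps)))
... | record { factors = [] ; isFactorisation = () }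
primeFactor {suc zero} (s≤s ())

exactPower : ∀ {p} → Prime p → ∀ n → n ≢ 0 → ∃₂ λ a m → n ≡ p ^ a * m × ¬ p ∣ m
exactPower {p} pp = <-rec _ go
  where
  Split : ℕ → Set
  Split n = ∃₂ λ a m → n ≡ p ^ a * m × ¬ p ∣ m
  go : ∀ n → (∀ {k} → k < n → k ≢ 0 → Split k) → n ≢ 0 → Split n
  go n rec n≢0 with p ∣? n
  ... | no p∤n = 0 , n , sym (+-identityʳ n) , p∤n
  ... | yes (divides k refl) with rec k<k*p k≢0
    where
    k≢0 : k ≢ 0
    k≢0 refl = n≢0 refl
    k<k*p : k < k * p
    k<k*p = m<m*n k p {{≢-nonZero k≢0}} (prime>1 pp)
  ... | a , m , refl , p∤m = suc a , m , trans (*-comm (p ^ a * m) p) (sym (*-assoc p (p ^ a) m)) , p∤m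

primePowerSplit : ∀ {n} → 2 ≤ n →
                  ∃ λ p → ∃₂ λ a m → Prime p × 1 ≤ a × ¬ p ∣ m × n ≡ p ^ a * m
primePowerSplit {n} 2≤n with primeFactor 2≤n
... | p , pp , p∣n with exactPower pp n (m<n⇒n≢0 2≤n)
...   | zero  , m , n≡1*m , p∤m = ⊥-elim (p∤m (subst (p ∣_) (trans n≡1*m (*-identityˡ m)) p∣n))
...   | suc a , m , n≡p^a*m , p∤m = p , suc a , m , pp , s≤s z≤n , p∤m , n≡p^a*m


-- Divisors, prime divisors, ω and κ

∈-range⁺ : ∀ {x n} → 1 ≤ x → x ≤ n → x ∈ range n
∈-range⁺ {suc x} _ x<n = ∈-map⁺ suc (∈-upTo⁺ x<n)

∈-range⁻ : ∀ {x n} → x ∈ range n → 1 ≤ x × x ≤ n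
∈-range⁻ x∈ with ∈-map⁻ suc x∈
... | _ , k∈ , refl = s≤s z≤n , ∈-upTo⁻ k∈

range-unique : ∀ n → Unique (range n)
range-unique n = Unique.map⁺ suc-injective (Unique.upTo⁺ n)

∣-≢0 : ∀ {d n} → d ∣ n → n ≢ 0 → d ≢ 0
∣-≢0 d∣n n≢0 refl = n≢0 (0∣⇒≡0 d∣n)

∣⇒∈-range : ∀ {d n} → n ≢ 0 → d ≢ 0 → d ∣ n → d ∈ range n
∣⇒∈-range n≢0 d≢0 d∣n = ∈-range⁺ (n≢0⇒n>0 d≢0) (∣⇒≤ {{≢-nonZero n≢0}} d∣n)

∈-divisors⁺ : ∀ {d n} → n ≢ 0 → d ∣ n → d ∈ divisors n
∈-divisors⁺ {d} {n} n≢0 d∣n = ∈-filter⁺ (_∣? n) (∣⇒∈-range n≢0 (∣-≢0 d∣n n≢0) d∣n) d∣n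

∈-divisors⁻ : ∀ {d n} → d ∈ divisors n → d ∣ n
∈-divisors⁻ {n = n} = proj₂ ∘ ∈-filter⁻ (_∣? n) {xs = range n}

divisors-unique : ∀ n → Unique (divisors n)
divisors-unique n = Unique.filter⁺ (_∣? n) (range-unique n)

primeDivisor? : ∀ n p → Dec (Prime p × p ∣ n)
primeDivisor? n p = prime? p ×-dec p ∣? n

∈-primeDivisors⁺ : ∀ {p n} → n ≢ 0 → Prime p → p ∣ n → p ∈ primeDivisors n
∈-primeDivisors⁺ {p} {n} n≢0 pp p∣n =
  ∈-filter⁺ (primeDivisor? n) (∣⇒∈-range n≢0 (≢-nonZero⁻¹ p {{prime⇒nonZero pp}}) p∣n) (pp , p∣n)

∈-primeDivisors⁻ : ∀ {p n} → p ∈ primeDivisors n → Prime p × p ∣ n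
∈-primeDivisors⁻ {n = n} = proj₂ ∘ ∈-filter⁻ (primeDivisor? n) {xs = range n}

primeDivisors-unique : ∀ n → Unique (primeDivisors n)
primeDivisors-unique n = Unique.filter⁺ (primeDivisor? n) (range-unique n)

primeDivisors-p^a* : ∀ {p a m} → Prime p → 1 ≤ a → m ≢ 0 → ¬ p ∣ m →
                     primeDivisors (p ^ a * m) ↭ p ∷ primeDivisors m
primeDivisors-p^a* {p} {a} {m} pp 1≤a m≢0 p∤m =
  unique-set⇒↭ (primeDivisors-unique (p ^ a * m)) (p∉ ∷ primeDivisors-unique m) to from
  where
  q*m≢0 = m≢0∧n≢0⇒m*n≢0 (prime^a≢0 pp a) m≢0
  p∉ : All (p ≢_) (primeDivisors m)
  p∉ = All.tabulate (λ x∈ p≡x → p∤m (subst (_∣ m) (sym p≡x) (proj₂ (∈-primeDivisors⁻ x∈))))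
  to : ∀ {x} → x ∈ primeDivisors (p ^ a * m) → x ∈ p ∷ primeDivisors m
  to x∈ with ∈-primeDivisors⁻ x∈
  ... | px , x∣q*m with euclidsLemma (p ^ a) m px x∣q*m
  ...   | inj₁ x∣q = here (prime∣p^a⇒≡ px pp a x∣q)
  ...   | inj₂ x∣m = there (∈-primeDivisors⁺ m≢0 px x∣m)
  from : ∀ {x} → x ∈ p ∷ primeDivisors m → x ∈ primeDivisors (p ^ a * m)
  from (here refl) = ∈-primeDivisors⁺ q*m≢0 pp (∣m⇒∣m*n m (p∣p^a p 1≤a))
  from (there x∈)  = let px , x∣m = ∈-primeDivisors⁻ x∈
                     in  ∈-primeDivisors⁺ q*m≢0 px (∣n⇒∣m*n (p ^ a) x∣m)

ω-p^a* : ∀ {p a m} → Prime p → 1 ≤ a → m ≢ 0 → ¬ p ∣ m → ω (p ^ a * m) ≡ suc (ω m)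
ω-p^a* pp 1≤a m≢0 p∤m = ↭.↭-length (primeDivisors-p^a* pp 1≤a m≢0 p∤m)

κ-p^a : ∀ {p a} → Prime p → 1 ≤ a → κ (p ^ a) ≡ p
κ-p^a {p} {a} pp 1≤a = begin
  κ (p ^ a)                  ≡⟨ cong κ (sym (*-identityʳ (p ^ a))) ⟩
  κ (p ^ a * 1)              ≡⟨ product-↭ (primeDivisors-p^a* pp 1≤a (λ ()) (prime≢1 pp ∘ ∣1⇒≡1)) ⟩
  p * 1                      ≡⟨ *-identityʳ p ⟩
  p                          ∎
  where open ≡-Reasoning

∈⇒∣product : ∀ {x xs} → x ∈ xs → x ∣ product xs
∈⇒∣product {xs = y ∷ ys} (here refl) = m∣m*n (product ys)
∈⇒∣product {xs = y ∷ ys} (there x∈) = ∣n⇒∣m*n y (∈⇒∣product x∈)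

prime∣κ : ∀ {p n} → n ≢ 0 → Prime p → p ∣ n → p ∣ κ n
prime∣κ n≢0 pp p∣n = ∈⇒∣product (∈-primeDivisors⁺ n≢0 pp p∣n)


-- Unitary divisors

infix 4 _∥_
_∥_ : ℕ → ℕ → Set
d ∥ n = ∃ λ e → d * e ≡ n × Coprime d e

∥⇒∣ : ∀ {d n} → d ∥ n → d ∣ n
∥⇒∣ {d} (e , de≡n , _) = divides e (trans (sym de≡n) (*-comm d e))

-- n / d by pattern matching, so that signedPow d (cofactor n d) is literally the summand of
-- expΛstar at d = suc k; the value at d = 0 is junk.
cofactor : ℕ → ℕ → ℕ
cofactor n zero    = zero
cofactor n (suc k) = n / suc k

cofactor-* : ∀ {d e n} → n ≢ 0 → d * e ≡ n → cofactor n d ≡ e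
cofactor-* {zero}          n≢0 refl = ⊥-elim (n≢0 refl)
cofactor-* {suc k} {e} _ refl = trans (cong (_/ suc k) (*-comm (suc k) e)) (m*n/n≡m e (suc k))

cofactor-split : ∀ {q m d e} → q * m ≢ 0 → d * e ≡ m →
                 cofactor (q * m) d ≡ q * e × cofactor (q * m) (q * d) ≡ e
cofactor-split {q} {d = d} {e} q*m≢0 de≡m =
  cofactor-* {d} {q * e} q*m≢0 (trans (x*[y*z]≡y*[x*z] d q e) (cong (q *_) de≡m)) ,
  cofactor-* {q * d} {e} q*m≢0 (trans (*-assoc q d e) (cong (q *_) de≡m))

unitary? : ∀ n k → Dec (suc k ∣ n × gcd (suc k) (n / suc k) ≡ 1)
unitary? n k = (suc k ∣? n) ×-dec (gcd (suc k) (n / suc k) ≟ 1)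

∈-unitaryDivisors⁺ : ∀ {d n} → n ≢ 0 → d ∥ n → d ∈ unitaryDivisors n
∈-unitaryDivisors⁺ {zero}      n≢0 (_ , refl , _) = ⊥-elim (n≢0 refl)
∈-unitaryDivisors⁺ {suc k} {n} n≢0 d∥n@(e , de≡n , cop) =
  ∈-map⁺ suc (∈-filter⁺ (unitary? n) (∈-upTo⁺ (∣⇒≤ {{≢-nonZero n≢0}} (∥⇒∣ d∥n))) (∥⇒∣ d∥n , gcd≡1))
  where gcd≡1 = coprime⇒gcd≡1 (subst (Coprime (suc k)) (sym (cofactor-* n≢0 de≡n)) cop)

∈-unitaryDivisors⁻ : ∀ {d n} → d ∈ unitaryDivisors n → d ∥ n
∈-unitaryDivisors⁻ {n = n} d∈ with ∈-map⁻ suc d∈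
... | k , k∈ , refl with ∈-filter⁻ (unitary? n) {xs = upTo n} k∈
...   | _ , d∣n , gcd≡1 =
  n / suc k , trans (*-comm (suc k) (n / suc k)) (m/n*n≡m d∣n) , gcd≡1⇒coprime gcd≡1

unitaryDivisors-unique : ∀ n → Unique (unitaryDivisors n)
unitaryDivisors-unique n = Unique.map⁺ suc-injective
  (Unique.filter⁺ (unitary? n) (Unique.upTo⁺ n))

∥-p^a*⁻ : ∀ {p a m d} → Prime p → d ∥ p ^ a * m →
          d ∥ m ⊎ ∃ λ d′ → d ≡ p ^ a * d′ × d′ ∥ m
∥-p^a*⁻ {p} {a} {m} {d} pp (e , de≡qm , cop) with p ∣? d
... | yes p∣d =
  let p∤e = λ p∣e → prime≢1 pp (cop (p∣d , p∣e))
      d′ , d≡qd′ , d′e≡m =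
        coprime-cancel (prime^a≢0 pp a) (Coprime.sym (coprime-p^a pp p∤e a)) de≡qm
  in  inj₂ (d′ , d≡qd′ , e , d′e≡m , coprime-∣ cop (divides (p ^ a) d≡qd′) ∣-refl)
... | no p∤d =
  let e′ , e≡qe′ , e′d≡m =
        coprime-cancel (prime^a≢0 pp a) (Coprime.sym (coprime-p^a pp p∤d a)) (trans (*-comm e d) de≡qm)
  in  inj₁ (e′ , trans (*-comm d e′) e′d≡m , coprime-∣ cop ∣-refl (divides (p ^ a) e≡qe′))

∥-p^a*⁺ : ∀ {p a m d} → Prime p → ¬ p ∣ m → d ∥ m → d ∥ p ^ a * m
∥-p^a*⁺ {p} {a} {m} {d} pp p∤m d∥m@(e , de≡m , cop) =
  p ^ a * e ,
  trans (x*[y*z]≡y*[x*z] d (p ^ a) e) (cong (p ^ a *_) de≡m) ,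
  coprime-* (coprime-p^a pp p∤d a) cop
  where p∤d = λ p∣d → p∤m (∣-trans p∣d (∥⇒∣ d∥m))

p^a*-∥-p^a* : ∀ {p a m d} → Prime p → ¬ p ∣ m → d ∥ m → p ^ a * d ∥ p ^ a * m
p^a*-∥-p^a* {p} {a} {m} {d} pp p∤m (e , de≡m , cop) =
  e ,
  trans (*-assoc (p ^ a) d e) (cong (p ^ a *_) de≡m) ,
  Coprime.sym (coprime-* (coprime-p^a pp p∤e a) (Coprime.sym cop))
  where p∤e = λ p∣e → p∤m (∣-trans p∣e (divides d (sym de≡m)))

unitaryDivisors-p^a* : ∀ {p a m} → Prime p → 1 ≤ a → m ≢ 0 → ¬ p ∣ m →
                       unitaryDivisors (p ^ a * m) ↭ unitaryDivisors m ++ map (p ^ a *_) (unitaryDivisors m)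
unitaryDivisors-p^a* {p} {a} {m} pp 1≤a m≢0 p∤m =
  unique-set⇒↭ (unitaryDivisors-unique (p ^ a * m)) split-unique to from
  where
  U = unitaryDivisors m
  q≢0 = prime^a≢0 pp a
  q*m≢0 = m≢0∧n≢0⇒m*n≢0 q≢0 m≢0
  split-unique : Unique (U ++ map (p ^ a *_) U)
  split-unique = Unique.++⁺ (unitaryDivisors-unique m)
    (Unique.map⁺ (*-cancelˡ-≡ _ _ (p ^ a) {{≢-nonZero q≢0}}) (unitaryDivisors-unique m))
    λ (d∈ , d∈q*U) → let d′ , _ , d≡qd′ = ∈-map⁻ (p ^ a *_) d∈q*U
                         p∣d = subst (p ∣_) (sym d≡qd′) (∣m⇒∣m*n d′ (p∣p^a p 1≤a))
                     in  p∤m (∣-trans p∣d (∥⇒∣ (∈-unitaryDivisors⁻ d∈)))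
  to : ∀ {d} → d ∈ unitaryDivisors (p ^ a * m) → d ∈ U ++ map (p ^ a *_) U
  to d∈ with ∥-p^a*⁻ {a = a} pp (∈-unitaryDivisors⁻ d∈)
  ... | inj₁ d∥m                = ∈-++⁺ˡ (∈-unitaryDivisors⁺ m≢0 d∥m)
  ... | inj₂ (d′ , refl , d′∥m) = ∈-++⁺ʳ U (∈-map⁺ (p ^ a *_) (∈-unitaryDivisors⁺ m≢0 d′∥m))
  from : ∀ {d} → d ∈ U ++ map (p ^ a *_) U → d ∈ unitaryDivisors (p ^ a * m)
  from d∈ with ∈-++⁻ U d∈
  ... | inj₁ d∈U = ∈-unitaryDivisors⁺ q*m≢0 (∥-p^a*⁺ {a = a} pp p∤m (∈-unitaryDivisors⁻ d∈U))
  ... | inj₂ d∈q*U with ∈-map⁻ (p ^ a *_) d∈q*U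
  ...   | d′ , d′∈U , refl = ∈-unitaryDivisors⁺ q*m≢0 (p^a*-∥-p^a* {a = a} pp p∤m (∈-unitaryDivisors⁻ d′∈U))

prodℚ-unitaryDivisors-p^a* : ∀ {p a m} → Prime p → 1 ≤ a → m ≢ 0 → ¬ p ∣ m → ∀ f →
                             prodℚ (map f (unitaryDivisors (p ^ a * m))) ≡
                             prodℚ (map (λ d → f d ℚ.* f (p ^ a * d)) (unitaryDivisors m))
prodℚ-unitaryDivisors-p^a* {p} {a} {m} pp 1≤a m≢0 p∤m f = begin
  prodℚ (map f (unitaryDivisors (p ^ a * m)))
    ≡⟨ prodℚ-↭ (↭.map⁺ f (unitaryDivisors-p^a* pp 1≤a m≢0 p∤m)) ⟩
  prodℚ (map f (U ++ map (p ^ a *_) U))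
    ≡⟨ cong prodℚ (map-++ f U (map (p ^ a *_) U)) ⟩
  prodℚ (map f U ++ map f (map (p ^ a *_) U))
    ≡⟨ prodℚ-++ (map f U) _ ⟩
  prodℚ (map f U) ℚ.* prodℚ (map f (map (p ^ a *_) U))
    ≡⟨ cong (λ xs → prodℚ (map f U) ℚ.* prodℚ xs) (sym (map-∘ U)) ⟩
  prodℚ (map f U) ℚ.* prodℚ (map (λ d → f (p ^ a * d)) U)
    ≡⟨ sym (prodℚ-map-* f (λ d → f (p ^ a * d)) U) ⟩
  prodℚ (map (λ d → f d ℚ.* f (p ^ a * d)) U)
    ∎
  where
  open ≡-Reasoning
  U = unitaryDivisors m


-- The unitary von Mangoldt function

expΛstar≡∏ : ∀ n →
             expΛstar n ≡ prodℚ (map (λ d → signedPow d (cofactor n d)) (unitaryDivisors n))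
expΛstar≡∏ n = cong prodℚ (map-∘ (filter (unitary? n) (upTo n)))

expΛstar-p^a* : ∀ {p a m} → Prime p → 1 ≤ a → m ≢ 0 → ¬ p ∣ m →
                expΛstar (p ^ a * m) ≡ prodℚ (map (λ d → signedPow (p ^ a) (cofactor m d)) (unitaryDivisors m))
expΛstar-p^a* {p} {a} {m} pp 1≤a m≢0 p∤m = begin
  expΛstar (q * m)                                                   ≡⟨ expΛstar≡∏ (q * m) ⟩
  prodℚ (map F (unitaryDivisors (q * m)))                            ≡⟨ prodℚ-unitaryDivisors-p^a* pp 1≤a m≢0 p∤m F ⟩
  prodℚ (map (λ d → F d ℚ.* F (q * d)) (unitaryDivisors m))          ≡⟨ prodℚ-cong pair ⟩
  prodℚ (map (λ d → signedPow q (cofactor m d)) (unitaryDivisors m)) ∎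
  where
  open ≡-Reasoning
  q = p ^ a
  q≢0 = prime^a≢0 pp a
  F : ℕ → ℚ
  F d = signedPow d (cofactor (q * m) d)
  pair : ∀ {d} → d ∈ unitaryDivisors m → F d ℚ.* F (q * d) ≡ signedPow q (cofactor m d)
  pair {d} d∈ with ∈-unitaryDivisors⁻ d∈
  ... | d∥m@(e , de≡m , _) = begin
    F d ℚ.* F (q * d)
      ≡⟨ cong₂ (λ u v → signedPow d u ℚ.* signedPow (q * d) v) cof-d cof-qd ⟩
    signedPow d (q * e) ℚ.* signedPow (q * d) e
      ≡⟨ signedPow-cancel d q {{d≢0}} {{≢-nonZero q≢0}} ω[q*e]≡1+ω[e] ⟩
    signedPow q e
      ≡⟨ cong (signedPow q) (cofactor-* {d} {e} m≢0 de≡m) ⟨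
    signedPow q (cofactor m d)
      ∎
    where
    e∣m = divides d (sym de≡m)
    d≢0 = ≢-nonZero (∣-≢0 (∥⇒∣ d∥m) m≢0)
    cof-d×cof-qd = cofactor-split {q} {m} {d} {e} (m≢0∧n≢0⇒m*n≢0 q≢0 m≢0) de≡m
    cof-d = proj₁ cof-d×cof-qd
    cof-qd = proj₂ cof-d×cof-qd
    ω[q*e]≡1+ω[e] = ω-p^a* {p} {a} {e} pp 1≤a (∣-≢0 e∣m m≢0) λ p∣e → p∤m (∣-trans p∣e e∣m)

∏-signedPow-cofactor≡1 : ∀ {m} → 2 ≤ m → ∀ x →
  prodℚ (map (λ d → signedPow x (cofactor m d)) (unitaryDivisors m)) ≡ 1ℚ
∏-signedPow-cofactor≡1 {m} 2≤m x with primePowerSplit 2≤m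
... | r , b , t , pr , 1≤b , r∤t , refl = begin
  prodℚ (map G (unitaryDivisors (s * t)))
    ≡⟨ prodℚ-unitaryDivisors-p^a* pr 1≤b t≢0 r∤t G ⟩
  prodℚ (map (λ d → G d ℚ.* G (s * d)) (unitaryDivisors t))
    ≡⟨ prodℚ-ones pair ⟩
  1ℚ
    ∎
  where
  open ≡-Reasoning
  s = r ^ b
  t≢0 : t ≢ 0
  t≢0 t≡0 = m<n⇒n≢0 2≤m (trans (cong (s *_) t≡0) (*-zeroʳ s))
  G : ℕ → ℚ
  G d = signedPow x (cofactor (s * t) d)
  pair : ∀ {d} → d ∈ unitaryDivisors t → G d ℚ.* G (s * d) ≡ 1ℚ
  pair {d} d∈ with ∈-unitaryDivisors⁻ d∈
  ... | e , de≡t , _ = begin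
    G d ℚ.* G (s * d)                      ≡⟨ cong₂ (λ u v → signedPow x u ℚ.* signedPow x v) cof-d cof-sd ⟩
    signedPow x (s * e) ℚ.* signedPow x e  ≡⟨ signedPow-inverse x ω[s*e]≡1+ω[e] ⟩
    1ℚ                                     ∎
    where
    e∣t = divides d (sym de≡t)
    cof-d×cof-sd = cofactor-split {s} {t} {d} {e} (m<n⇒n≢0 2≤m) de≡t
    cof-d = proj₁ cof-d×cof-sd
    cof-sd = proj₂ cof-d×cof-sd
    ω[s*e]≡1+ω[e] = ω-p^a* {r} {b} {e} pr 1≤b (∣-≢0 e∣t t≢0) λ r∣e → r∤t (∣-trans r∣e e∣t)

expΛstar-p^a : ∀ {p a} → Prime p → 1 ≤ a → expΛstar (p ^ a) ≡ ⟦ p ^ a ⟧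
expΛstar-p^a {p} {a} pp 1≤a = begin
  expΛstar (p ^ a)             ≡⟨ cong expΛstar (*-identityʳ (p ^ a)) ⟨
  expΛstar (p ^ a * 1)         ≡⟨ expΛstar-p^a* pp 1≤a (λ ()) (prime≢1 pp ∘ ∣1⇒≡1) ⟩
  signedPow (p ^ a) 1 ℚ.* 1ℚ   ≡⟨ ℚ.*-identityʳ _ ⟩
  signedPow (p ^ a) 1          ≡⟨ signedPow-1 (p ^ a) {{≢-nonZero (prime^a≢0 pp a)}} ⟩
  ⟦ p ^ a ⟧                    ∎
  where open ≡-Reasoning

expΛstar-p^a*m≡1 : ∀ {p a m} → Prime p → 1 ≤ a → 2 ≤ m → ¬ p ∣ m →
                   expΛstar (p ^ a * m) ≡ 1ℚ
expΛstar-p^a*m≡1 {p} {a} pp 1≤a 2≤m p∤m =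
  trans (expΛstar-p^a* pp 1≤a (m<n⇒n≢0 2≤m) p∤m) (∏-signedPow-cofactor≡1 2≤m (p ^ a))


-- The von Mangoldt function

Λterm : ℕ → ℕ → ℕ → List ℚ
Λterm d p k with p ^ k ≟ d
... | yes _ = ⟦ p ⟧ ∷ []
... | no  _ = []

-- The local function `term` in the definition of expΛ cannot be named here: term≡Λterm states its
-- equations through the `_` in its type, which is solved from the use in expΛ≡ (hence the mutual block).
mutual
  expΛ≡ : ∀ d → expΛ d ≡ prodℚ (concatMap (λ p → concatMap (Λterm d p) (range d)) (filter prime? (range d)))
  expΛ≡ d = cong prodℚ (concatMap-cong (λ p → concatMap-cong (term≡Λterm d p) (range d)) (filter prime? (range d)))

  term≡Λterm : ∀ d p k → _ ≡ Λterm d p k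
  term≡Λterm d p k with p ^ k ≟ d
  ... | yes _ = refl
  ... | no  _ = refl

Λterm-≡ : ∀ {d p k} → p ^ k ≡ d → Λterm d p k ≡ ⟦ p ⟧ ∷ []
Λterm-≡ {d} {p} {k} pᵏ≡d with p ^ k ≟ d
... | yes _   = refl
... | no pᵏ≢d = ⊥-elim (pᵏ≢d pᵏ≡d)

Λterm-≢ : ∀ {d p k} → p ^ k ≢ d → Λterm d p k ≡ []
Λterm-≢ {d} {p} {k} pᵏ≢d with p ^ k ≟ d
... | yes pᵏ≡d = ⊥-elim (pᵏ≢d pᵏ≡d)
... | no _     = refl

expΛ-p^j : ∀ {p j} → Prime p → 1 ≤ j → expΛ (p ^ j) ≡ ⟦ p ⟧
expΛ-p^j {p} {j} pp 1≤j = begin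
  expΛ d                        ≡⟨ expΛ≡ d ⟩
  prodℚ (concatMap terms primes) ≡⟨ cong prodℚ (trans only-p only-j) ⟩
  ⟦ p ⟧ ℚ.* 1ℚ                  ≡⟨ ℚ.*-identityʳ ⟦ p ⟧ ⟩
  ⟦ p ⟧                         ∎
  where
  open ≡-Reasoning
  d = p ^ j
  primes = filter prime? (range d)
  terms : ℕ → List ℚ
  terms p′ = concatMap (Λterm d p′) (range d)
  p∈primes : p ∈ primes
  p∈primes = ∈-filter⁺ prime? (∣⇒∈-range (prime^a≢0 pp j) (≢-nonZero⁻¹ p {{prime⇒nonZero pp}}) (p∣p^a p 1≤j)) pp
  only-p : concatMap terms primes ≡ terms p
  only-p = concatMap-single terms (Unique.filter⁺ prime? (range-unique d)) p∈primes
    λ {p′} p′∈ p′≢p → concatMap-[] (Λterm d p′) {range d} λ k∈ → Λterm-≢ λ p′ᵏ≡d →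
      p′≢p (prime∣p^a⇒≡ (proj₂ (∈-filter⁻ prime? {xs = range d} p′∈)) pp j
                         (subst (p′ ∣_) p′ᵏ≡d (p∣p^a p′ (proj₁ (∈-range⁻ k∈)))))
  only-j : terms p ≡ ⟦ p ⟧ ∷ []
  only-j = trans
    (concatMap-single (Λterm d p) (range-unique d) (∈-range⁺ 1≤j (<⇒≤ (n<m^n (prime>1 pp) j)))
                      λ _ k≢j → Λterm-≢ (k≢j ∘ ^-injectiveʳ (prime>1 pp)))
    (Λterm-≡ refl)

expΛ-nonPrimePower : ∀ {d} → (∀ {p k} → Prime p → 1 ≤ k → p ^ k ≢ d) → expΛ d ≡ 1ℚ
expΛ-nonPrimePower {d} notPrimePower = trans (expΛ≡ d) (cong prodℚ
  (concatMap-[] (λ p → concatMap (Λterm d p) (range d)) λ {p} p∈ →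
     concatMap-[] (Λterm d p) {range d} λ k∈ →
       Λterm-≢ (notPrimePower (proj₂ (∈-filter⁻ prime? {xs = range d} p∈)) (proj₁ (∈-range⁻ k∈)))))

sameKernel? : ∀ n d → Dec (κ d ≡ κ n)
sameKernel? n d = κ d ≟ κ n

sameKernelDivisors : ℕ → List ℕ
sameKernelDivisors n = filter (sameKernel? n) (divisors n)

∈-sameKernelDivisors⁺ : ∀ {d n} → n ≢ 0 → d ∣ n → κ d ≡ κ n → d ∈ sameKernelDivisors n
∈-sameKernelDivisors⁺ {n = n} n≢0 d∣n = ∈-filter⁺ (sameKernel? n) (∈-divisors⁺ n≢0 d∣n)

∈-sameKernelDivisors⁻ : ∀ {d n} → d ∈ sameKernelDivisors n → d ∣ n × κ d ≡ κ n
∈-sameKernelDivisors⁻ {n = n} d∈ =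
  let d∈divisors , κd≡κn = ∈-filter⁻ (sameKernel? n) {xs = divisors n} d∈
  in  ∈-divisors⁻ d∈divisors , κd≡κn

sameKernelDivisors-p^a : ∀ {p a} → Prime p → 1 ≤ a →
                         sameKernelDivisors (p ^ a) ↭ map (p ^_) (range a)
sameKernelDivisors-p^a {p} {a} pp 1≤a = unique-set⇒↭
  (Unique.filter⁺ (sameKernel? (p ^ a)) (divisors-unique (p ^ a)))
  (Unique.map⁺ (^-injectiveʳ (prime>1 pp)) (range-unique a)) to from
  where
  to : ∀ {d} → d ∈ sameKernelDivisors (p ^ a) → d ∈ map (p ^_) (range a)
  to d∈ with ∈-sameKernelDivisors⁻ d∈
  ... | d∣p^a , κd≡κp^a with ∣p^a⇒≡p^j pp a d∣p^a
  ...   | zero  , _   , refl = ⊥-elim (prime≢1 pp (trans (sym (κ-p^a pp 1≤a)) (sym κd≡κp^a)))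
  ...   | suc j , j<a , refl = ∈-map⁺ (p ^_) (∈-range⁺ (s≤s z≤n) j<a)
  from : ∀ {d} → d ∈ map (p ^_) (range a) → d ∈ sameKernelDivisors (p ^ a)
  from d∈ with ∈-map⁻ (p ^_) d∈
  ... | j , j∈ , refl =
    let 1≤j , j≤a = ∈-range⁻ j∈
    in  ∈-sameKernelDivisors⁺ (prime^a≢0 pp a) (m^i∣m^j p j≤a) (trans (κ-p^a pp 1≤j) (sym (κ-p^a pp 1≤a)))

expRHS-p^a : ∀ {p a} → Prime p → 1 ≤ a → expRHS (p ^ a) ≡ ⟦ p ^ a ⟧
expRHS-p^a {p} {a} pp 1≤a = begin
  prodℚ (map expΛ (sameKernelDivisors (p ^ a)))
    ≡⟨ prodℚ-↭ (↭.map⁺ expΛ (sameKernelDivisors-p^a pp 1≤a)) ⟩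
  prodℚ (map expΛ (map (p ^_) (range a)))
    ≡⟨ cong prodℚ (map-∘ (range a)) ⟨
  prodℚ (map (λ j → expΛ (p ^ j)) (range a))
    ≡⟨ prodℚ-cong {xs = range a} (λ {j} j∈ → expΛ-p^j {p} {j} pp (proj₁ (∈-range⁻ {j} {a} j∈))) ⟩
  prodℚ (map (λ _ → ⟦ p ⟧) (range a))
    ≡⟨ prodℚ-const p (range a) ⟩
  ⟦ p ^ length (range a) ⟧
    ≡⟨ cong (λ l → ⟦ p ^ l ⟧) (trans (length-map suc (upTo a)) (length-upTo a)) ⟩
  ⟦ p ^ a ⟧
    ∎
  where open ≡-Reasoning

expRHS≡1 : ∀ {n p r} → n ≢ 0 → Prime p → Prime r → p ≢ r → p ∣ n → r ∣ n → expRHS n ≡ 1ℚ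
expRHS≡1 {n} n≢0 pp pr p≢r p∣n r∣n =
  prodℚ-ones {xs = sameKernelDivisors n} λ {d} d∈ → expΛ-nonPrimePower {d} λ p′prime 1≤k p′ᵏ≡d →
    let κn≡p′ = trans (sym (proj₂ (∈-sameKernelDivisors⁻ {d} {n} d∈)))
                      (trans (cong κ (sym p′ᵏ≡d)) (κ-p^a p′prime 1≤k))
        p≡p′  = prime∣prime⇒≡ pp p′prime (subst (_ ∣_) κn≡p′ (prime∣κ n≢0 pp p∣n))
        r≡p′  = prime∣prime⇒≡ pr p′prime (subst (_ ∣_) κn≡p′ (prime∣κ n≢0 pr r∣n))
    in  p≢r (trans p≡p′ (sym r≡p′))


corollary5-p^a : ∀ {p a} → Prime p → 1 ≤ a → expΛstar (p ^ a) ≡ expRHS (p ^ a)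
corollary5-p^a pp 1≤a = trans (expΛstar-p^a pp 1≤a) (sym (expRHS-p^a pp 1≤a))

corollary5-p^a*m : ∀ {p a m} → Prime p → 1 ≤ a → 2 ≤ m → ¬ p ∣ m →
                   expΛstar (p ^ a * m) ≡ expRHS (p ^ a * m)
corollary5-p^a*m {p} {a} {m} pp 1≤a 2≤m p∤m with primeFactor 2≤m
... | r , pr , r∣m = trans (expΛstar-p^a*m≡1 pp 1≤a 2≤m p∤m) (sym (expRHS≡1 n≢0 pp pr p≢r p∣n r∣n))
  where
  n≢0 = m≢0∧n≢0⇒m*n≢0 (prime^a≢0 pp a) (m<n⇒n≢0 2≤m)
  p≢r = λ { refl → p∤m r∣m }
  p∣n = ∣m⇒∣m*n m (p∣p^a p 1≤a)
  r∣n = ∣n⇒∣m*n (p ^ a) r∣m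

corollary5 : (n : ℕ) → 1 ≤ n → expΛstar n ≡ expRHS n
corollary5 (suc zero)      _ = refl
corollary5 n@(suc (suc _)) _ with primePowerSplit {n} (s≤s (s≤s z≤n))
... | p , a , zero , _ , _ , _ , n≡p^a*0 = ⊥-elim (1+n≢0 (trans n≡p^a*0 (*-zeroʳ (p ^ a))))
... | p , a , suc zero , pp , 1≤a , _ , n≡p^a*1 =
  subst (λ k → expΛstar k ≡ expRHS k) (sym (trans n≡p^a*1 (*-identityʳ (p ^ a)))) (corollary5-p^a pp 1≤a)
... | p , a , suc (suc _) , pp , 1≤a , p∤m , n≡p^a*m =
  subst (λ k → expΛstar k ≡ expRHS k) (sym n≡p^a*m) (corollary5-p^a*m pp 1≤a (s≤s (s≤s z≤n)) p∤m)
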